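{- Let $n$, $i_1$, $m$, $i_2$ be integers with $1 < i_1 < m < m+1 < i_2 < n$. Then the only $(x_1,\dots,x_n,y_1,\dots,y_n)\in\mathbb{R}^{2n}$ satisfying the system $\mathbb{L}_n(i_1;m;i_2)$ is the zero vector.
   Context: For integers $1 \le i_1 < m < m+1 < i_2 \le n$, $\mathbb{L}_n(i_1;m;i_2)$ is the following system of $2n$ linear equations in the real variables $x_1,\dots,x_n,y_1,\dots,y_n$, where $x_{n+1}$ is identified with $x_1$: $x_i + y_i = 0$ for $1 \le i \le n$; $x_{i+1} + y_i = 0$ for every $1 \le i \le n$ with $i \notin \{i_1-1, i_1, i_2-1, i_2, m\}$; $x_{i_2} + y_{i_1-1} = 0$; $x_{i_2+1} + y_{i_1} = 0$; $x_{i_1} + y_{i_2-1} = 0$; $x_{i_1+1} + y_{i_2} = 0$; and $y_m = 0$. -}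

module Defs where

open import Level using (_⊔_)
open import Algebra.Bundles using (CommutativeRing)
open import Data.Nat using (ℕ; suc; _≤_; _<_; _∸_; _≡ᵇ_)
open import Data.Bool using (if_then_else_)
open import Data.Product using (_×_)
open import Relation.Binary.PropositionalEquality using (_≢_)

-- Variables are 1-indexed: x i, y i for 1 ≤ i ≤ n (values at other indices are irrelevant).
-- Cyclic convention: x (n+1) is identified with x 1.
cyc : ∀ {a} {A : Set a} → ℕ → (ℕ → A) → ℕ → A
cyc n x j = if j ≡ᵇ suc n then x 1 else x j

module _ {c ℓ} (R : CommutativeRing c ℓ) where
  open CommutativeRing R

  𝕃 : (n i₁ m i₂ : ℕ) → (ℕ → Carrier) → (ℕ → Carrier) → Set ℓ
  𝕃 n i₁ m i₂ x y =
    (∀ i → 1 ≤ i → i ≤ n → x i + y i ≈ 0#) ×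
    (∀ i → 1 ≤ i → i ≤ n →
       i ≢ i₁ ∸ 1 → i ≢ i₁ → i ≢ i₂ ∸ 1 → i ≢ i₂ → i ≢ m →
       cyc n x (suc i) + y i ≈ 0#) ×
    (cyc n x i₂ + y (i₁ ∸ 1) ≈ 0#) ×
    (cyc n x (suc i₂) + y i₁ ≈ 0#) ×
    (cyc n x i₁ + y (i₂ ∸ 1) ≈ 0#) ×
    (cyc n x (suc i₁) + y i₂ ≈ 0#) ×
    (y m ≈ 0#)

{-# OPTIONS --safe #-}
-- Since x i + y i = 0, every generic equation x (i+1) + y i = 0 says x (i+1) = x i, so x is
-- constant on each of the cyclic arcs [i₂+1, i₁-1] (through n and 1), {i₁}, [i₁+1, m],
-- [m+1, i₂-1] and {i₂}. The four exceptional equations link the arcs into a single chain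
-- [i₁+1, m] → {i₂} → [i₂+1, i₁-1] → {i₁} → [m+1, i₂-1], and y m = 0 makes x vanish at the
-- start of the chain, hence everywhere; then y = -x vanishes too.
module Submission where

open import Defs
open import Algebra.Bundles using (CommutativeRing)
open import Data.Bool using (true; false)
open import Data.List using ([]; _∷_)
open import Data.List.Relation.Unary.All using (All; []; _∷_)
open import Data.Nat using (ℕ; zero; suc; _≤_; _<_; _≡ᵇ_; _≤?_; z≤n; s≤s)
open import Data.Nat.Properties
  using (≤-refl; ≤-trans; <⇒≤; ≤-pred; ≤-antisym; ≰⇒>; <⇒≢; >⇒≢; <-≤-trans;
         n≤1+n; n<1+n; m≤n⇒m≤1+n; m<n⇒m<1+n; m≤n⇒m<n∨m≡n)
open import Data.Product using (_×_; _,_)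
open import Data.Sum using (_⊎_; inj₁; inj₂)
open import Relation.Binary.Bundles using (Setoid)
open import Relation.Binary.PropositionalEquality as ≡ using (_≡_; _≢_; subst)
open import Relation.Nullary using (yes; no)

m<n⇒[m≡ᵇn]≡false : ∀ {m n} → m < n → (m ≡ᵇ n) ≡ false
m<n⇒[m≡ᵇn]≡false {zero}  {suc n} _         = ≡.refl
m<n⇒[m≡ᵇn]≡false {suc m} {suc n} (s≤s m<n) = m<n⇒[m≡ᵇn]≡false m<n

[n≡ᵇn]≡true : ∀ n → (n ≡ᵇ n) ≡ true
[n≡ᵇn]≡true zero    = ≡.refl
[n≡ᵇn]≡true (suc n) = [n≡ᵇn]≡true n

cyc-≤ : ∀ {a} {A : Set a} n (x : ℕ → A) {j} → j ≤ n → cyc n x j ≡ x j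
cyc-≤ n x {j} j≤n rewrite m<n⇒[m≡ᵇn]≡false (s≤s j≤n) = ≡.refl

cyc-wrap : ∀ {a} {A : Set a} n (x : ℕ → A) → cyc n x (suc n) ≡ x 1
cyc-wrap n x rewrite [n≡ᵇn]≡true n = ≡.refl

Between : ∀ {p} → ℕ → ℕ → (ℕ → Set p) → Set p
Between a b P = ∀ k → a ≤ k → k ≤ b → P k

module _ {p} {P : ℕ → Set p} where

  Between-point : ∀ {a} → P a → Between a a P
  Between-point Pa k a≤k k≤a = subst P (≤-antisym a≤k k≤a) Pa

  Between-join : ∀ {a b c} → Between a b P → Between (suc b) c P → Between a c P
  Between-join {b = b} left right k a≤k k≤c with k ≤? b
  ... | yes k≤b = left k a≤k k≤b
  ... | no  k≰b = right k (≰⇒> k≰b) k≤c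

module _ {c ℓ} (S : Setoid c ℓ) where
  open Setoid S

  Steady : (ℕ → Carrier) → ℕ → ℕ → Set ℓ
  Steady f a b = ∀ k → a ≤ k → k < b → f (suc k) ≈ f k

  steady⇒constant : ∀ {f a b} → Steady f a b → Between a b (λ k → f k ≈ f a)
  steady⇒constant steady k a≤k k≤b with m≤n⇒m<n∨m≡n a≤k
  ... | inj₂ ≡.refl = refl
  steady⇒constant steady (suc k) _ k<b | inj₁ (s≤s a≤k) =
    trans (steady k a≤k k<b) (steady⇒constant steady k a≤k (<⇒≤ k<b))

  steady⇒agree : ∀ {f a b j z} → Steady f a b → a ≤ j → j ≤ b → f j ≈ z →
                 Between a b (λ k → f k ≈ z)
  steady⇒agree steady a≤j j≤b fj≈z k a≤k k≤b =
    trans (steady⇒constant steady k a≤k k≤b) (trans (sym (steady⇒constant steady _ a≤j j≤b)) fj≈z)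

Avoids : ℕ → ℕ → ℕ → Set
Avoids a b s = s < a ⊎ b ≤ s

avoids⇒≢ : ∀ {a b s k} → Avoids a b s → a ≤ k → k < b → k ≢ s
avoids⇒≢ (inj₁ s<a) a≤k k<b = >⇒≢ (<-≤-trans s<a a≤k)
avoids⇒≢ (inj₂ b≤s) a≤k k<b = <⇒≢ (<-≤-trans k<b b≤s)

module _ {c ℓ} (R : CommutativeRing c ℓ) where
  open CommutativeRing R
  open import Algebra.Properties.Ring ring using (+-cancelʳ; +-inverseˡ-unique; +-inverseʳ-unique; -0#≈0#)

  x+y≈0⇒y≈0⇒x≈0 : ∀ {a b} → a + b ≈ 0# → b ≈ 0# → a ≈ 0#
  x+y≈0⇒y≈0⇒x≈0 {a} {b} a+b≈0 b≈0 = trans (+-inverseˡ-unique a b a+b≈0) (trans (-‿cong b≈0) -0#≈0#)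

  x+y≈0⇒x≈0⇒y≈0 : ∀ {a b} → a + b ≈ 0# → a ≈ 0# → b ≈ 0#
  x+y≈0⇒x≈0⇒y≈0 {a} {b} a+b≈0 a≈0 = trans (+-inverseʳ-unique a b a+b≈0) (trans (-‿cong a≈0) -0#≈0#)

  -- The components of 𝕃 R n i₁ m i₂ x y, with i₁ = suc p and i₂ = suc q.
  module System {n p m q : ℕ} {x y : ℕ → Carrier}
      (1≤p : 1 ≤ p) (p+1<m : suc p < m) (m<q : m < q) (q+1<n : suc q < n)
      (x+y≈0 : Between 1 n (λ i → x i + y i ≈ 0#))
      (generic : ∀ i → 1 ≤ i → i ≤ n → i ≢ p → i ≢ suc p → i ≢ q → i ≢ suc q → i ≢ m →
                 cyc n x (suc i) + y i ≈ 0#)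
      (e₃ : cyc n x (suc q) + y p ≈ 0#) (e₄ : cyc n x (suc (suc q)) + y (suc p) ≈ 0#)
      (e₅ : cyc n x (suc p) + y q ≈ 0#) (e₆ : cyc n x (suc (suc p)) + y (suc q) ≈ 0#)
      (yₘ≈0 : y m ≈ 0#) where

    -- Indexing by cyc n x makes the wrap-around equation at i = n an ordinary step X (n+1) ≈ X n.
    X : ℕ → Carrier
    X = cyc n x

    X≈x : ∀ {i} → i ≤ n → X i ≈ x i
    X≈x i≤n = reflexive (cyc-≤ n x i≤n)

    X+y≈0 : Between 1 n (λ i → X i + y i ≈ 0#)
    X+y≈0 i 1≤i i≤n = trans (+-congʳ (X≈x i≤n)) (x+y≈0 i 1≤i i≤n)

    paired⇒≈ : ∀ {i j} → X j + y i ≈ 0# → 1 ≤ i → i ≤ n → X j ≈ X i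
    paired⇒≈ {i} {j} e 1≤i i≤n = +-cancelʳ (y i) (X j) (X i) (trans e (sym (X+y≈0 i 1≤i i≤n)))

    Clear : ℕ → ℕ → Set
    Clear a b = All (Avoids a b) (p ∷ suc p ∷ q ∷ suc q ∷ m ∷ [])

    steady : ∀ {a b} → 1 ≤ a → b ≤ suc n → Clear a b → Steady setoid X a b
    steady {a} {b} 1≤a b≤1+n (c₁ ∷ c₂ ∷ c₃ ∷ c₄ ∷ c₅ ∷ []) k a≤k k<b =
      paired⇒≈ (generic k 1≤k k≤n (avoid c₁) (avoid c₂) (avoid c₃) (avoid c₄) (avoid c₅)) 1≤k k≤n
      where
      1≤k : 1 ≤ k
      1≤k = ≤-trans 1≤a a≤k
      k≤n : k ≤ n
      k≤n = ≤-pred (≤-trans k<b b≤1+n)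
      avoid : ∀ {s} → Avoids a b s → k ≢ s
      avoid c = avoids⇒≢ c a≤k k<b

    p≤m : p ≤ m
    p≤m = ≤-trans (n≤1+n p) (<⇒≤ p+1<m)

    m≤q : m ≤ q
    m≤q = <⇒≤ m<q

    p≤q : p ≤ q
    p≤q = ≤-trans p≤m m≤q

    q≤n : q ≤ n
    q≤n = ≤-trans (n≤1+n q) (<⇒≤ q+1<n)

    Zero : ℕ → Set ℓ
    Zero k = X k ≈ 0#

    paired-vanishes : ∀ {i j} → X j + y i ≈ 0# → 1 ≤ i → i ≤ n → Zero j → Zero i
    paired-vanishes e 1≤i i≤n Xⱼ≈0 = trans (sym (paired⇒≈ e 1≤i i≤n)) Xⱼ≈0

    arc-from-i₁+1-to-m : Between (suc (suc p)) m Zero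
    arc-from-i₁+1-to-m =
      steady⇒agree setoid (steady (s≤s z≤n) (m≤n⇒m≤1+n m≤n) clear) p+1<m ≤-refl Xₘ≈0
      where
      m≤n : m ≤ n
      m≤n = ≤-trans m≤q q≤n
      clear : Clear (suc (suc p)) m
      clear = inj₁ (m<n⇒m<1+n (n<1+n p)) ∷ inj₁ (n<1+n (suc p))
            ∷ inj₂ m≤q ∷ inj₂ (m≤n⇒m≤1+n m≤q) ∷ inj₂ ≤-refl ∷ []
      Xₘ≈0 : Zero m
      Xₘ≈0 = x+y≈0⇒y≈0⇒x≈0 (X+y≈0 m (≤-trans 1≤p p≤m) m≤n) yₘ≈0

    at-i₂ : Zero (suc q)
    at-i₂ = paired-vanishes e₆ (s≤s z≤n) (<⇒≤ q+1<n) (arc-from-i₁+1-to-m _ ≤-refl p+1<m)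

    arc-from-1-to-i₁-1 : Between 1 p Zero
    arc-from-1-to-i₁-1 =
      steady⇒agree setoid (steady ≤-refl (m≤n⇒m≤1+n p≤n) clear) 1≤p ≤-refl
        (paired-vanishes e₃ 1≤p p≤n at-i₂)
      where
      p≤n : p ≤ n
      p≤n = ≤-trans p≤q q≤n
      clear : Clear 1 p
      clear = inj₂ ≤-refl ∷ inj₂ (n≤1+n p) ∷ inj₂ p≤q ∷ inj₂ (m≤n⇒m≤1+n p≤q) ∷ inj₂ p≤m ∷ []

    arc-from-i₂+1-to-n+1 : Between (suc (suc q)) (suc n) Zero
    arc-from-i₂+1-to-n+1 =
      steady⇒agree setoid (steady (s≤s z≤n) ≤-refl clear) (m≤n⇒m≤1+n q+1<n) ≤-refl Xₙ₊₁≈0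
      where
      clear : Clear (suc (suc q)) (suc n)
      clear = inj₁ (s≤s (≤-trans p≤q (n≤1+n q))) ∷ inj₁ (s≤s (s≤s p≤q))
            ∷ inj₁ (m<n⇒m<1+n (n<1+n q)) ∷ inj₁ (n<1+n (suc q))
            ∷ inj₁ (s≤s (≤-trans m≤q (n≤1+n q))) ∷ []
      Xₙ₊₁≈0 : Zero (suc n)
      Xₙ₊₁≈0 = trans (reflexive (cyc-wrap n x))
                 (trans (sym (X≈x (≤-trans 1≤p (≤-trans p≤q q≤n))))
                        (arc-from-1-to-i₁-1 1 ≤-refl 1≤p))

    at-i₁ : Zero (suc p)
    at-i₁ = paired-vanishes e₄ (s≤s z≤n) (≤-trans (s≤s p≤q) (<⇒≤ q+1<n))
              (arc-from-i₂+1-to-n+1 _ ≤-refl (m≤n⇒m≤1+n q+1<n))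

    arc-from-m+1-to-i₂-1 : Between (suc m) q Zero
    arc-from-m+1-to-i₂-1 =
      steady⇒agree setoid (steady (s≤s z≤n) (m≤n⇒m≤1+n q≤n) clear) m<q ≤-refl
        (paired-vanishes e₅ (≤-trans 1≤p p≤q) q≤n at-i₁)
      where
      clear : Clear (suc m) q
      clear = inj₁ (s≤s p≤m) ∷ inj₁ (s≤s (<⇒≤ p+1<m))
            ∷ inj₂ ≤-refl ∷ inj₂ (n≤1+n q) ∷ inj₁ (n<1+n m) ∷ []

    X-vanishes : Between 1 n Zero
    X-vanishes =
      Between-join arc-from-1-to-i₁-1 (Between-join (Between-point at-i₁)
        (Between-join arc-from-i₁+1-to-m (Between-join arc-from-m+1-to-i₂-1
          (Between-join (Between-point at-i₂)
            (λ k q+2≤k k≤n → arc-from-i₂+1-to-n+1 k q+2≤k (m≤n⇒m≤1+n k≤n))))))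

    solution-vanishes : Between 1 n (λ i → x i ≈ 0# × y i ≈ 0#)
    solution-vanishes i 1≤i i≤n = xᵢ≈0 , x+y≈0⇒x≈0⇒y≈0 (x+y≈0 i 1≤i i≤n) xᵢ≈0
      where
      xᵢ≈0 : x i ≈ 0#
      xᵢ≈0 = trans (sym (X≈x i≤n)) (X-vanishes i 1≤i i≤n)

lemma4p1 : ∀ {c ℓ} (R : CommutativeRing c ℓ) (n i₁ m i₂ : ℕ) →
    1 < i₁ → i₁ < m → suc m < i₂ → i₂ < n →
    (x y : ℕ → CommutativeRing.Carrier R) →
    𝕃 R n i₁ m i₂ x y →
    ∀ i → 1 ≤ i → i ≤ n →
      CommutativeRing._≈_ R (x i) (CommutativeRing.0# R) ×
      CommutativeRing._≈_ R (y i) (CommutativeRing.0# R)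
lemma4p1 R n (suc p) m (suc q) (s≤s 1≤p) p+1<m (s≤s m<q) q+1<n x y
         (x+y≈0 , generic , e₃ , e₄ , e₅ , e₆ , yₘ≈0) =
  System.solution-vanishes R 1≤p p+1<m m<q q+1<n x+y≈0 generic e₃ e₄ e₅ e₆ yₘ≈0
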